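{- The set $SP_-$ of $(-)$-search paths is prefix-free, and the set $SP_+$ of $(+)$-search paths is suffix-free (as sets of edge sequences of $G$).
   Context: Let $T=T[1..n]$ be a text over an integer alphabet with total order, ending with a unique smallest end-marker $\$$. The CDAWG $G$ of $T$ is the edge-labeled DAG obtained from the suffix tree of $T$ by merging isomorphic subtrees; it has a root and a sink, and spelling root-to-sink paths is a bijection onto the suffixes of $T$; $E$ is its edge set. For a node $v$, $N_-(v)$/$N_+(v)$ are incoming/outgoing edges, $U_-(v)$ the strings spelled by root-to-$v$ paths, $U_+(v)$ those spelled by $v$-to-sink paths. With $\preceq_-=\le_{\mathrm{pos}}$ ($X\le_{\mathrm{pos}}Y$ iff $|X|\ge|Y|$) and $\preceq_+\in\{\le_{\mathrm{lex}},\le_{\mathrm{pos}}\}$, let $\mathrm{repr}_\delta(v)=\min_{\preceq_\delta}U_\delta(v)$. An edge of $N_-(v)$ is $(-)$-primary if it is the last edge of the path of $\mathrm{repr}_-(v)$; an edge of $N_+(v)$ is $(+)$-primary if it is the first edge of the path of $\mathrm{repr}_+(v)$; $EP_\delta$ = $\delta$-primary edges, $ES_\delta=E\setminus EP_\delta$. For a suffix with root-to-sink path $(f_1,\dots,f_\ell)$: if all $f_i\in EP_\delta$ ($\delta$-trivial), its $\delta$-search path is $(f_1,\dots,f_\ell)$; if for some $k$, $f_1,\dots,f_{k-1}\in EP_-$, $f_k\in ES_-$, $f_{k+1},\dots,f_\ell\in EP_+$, its $(-)$-search path is $(f_1,\dots,f_k)$; if for some $k$, $f_1,\dots,f_{k-1}\in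 EP_-$, $f_k\in ES_+$, $f_{k+1},\dots,f_\ell\in EP_+$, its $(+)$-search path is $(f_k,\dots,f_\ell)$. $SP_\delta$ is the set of all $\delta$-search paths. -}

module Defs where

open import Data.Nat using (ℕ; _≤_; _<_)
open import Data.List using (List; []; _∷_; _++_; _∷ʳ_; [_]; drop; length; concat; map)
open import Data.List.Relation.Unary.All using (All)
open import Data.List.Relation.Binary.Pointwise using (Pointwise)
open import Data.List.Relation.Binary.Lex.NonStrict using (Lex-≤)
open import Data.Product using (Σ; ∃; ∃₂; _×_; _,_; proj₁; proj₂)
open import Data.Sum using (_⊎_)
open import Relation.Binary.PropositionalEquality using (_≡_; _≢_)
open import Relation.Nullary using (¬_)
open import Function.Bundles using (_⇔_)

Str : Set
Str = List ℕ

-- T ends with a unique smallest end-marker $: T = w ++ [ d ] with d < every letter of w.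
ValidText : Str → Set
ValidText T = Σ Str λ w → Σ ℕ λ d → (T ≡ w ∷ʳ d) × All (d <_) w

_≤pos_ : Str → Str → Set
X ≤pos Y = length Y ≤ length X

-- lexicographic order (a proper prefix is smaller)
_≤lex_ : Str → Str → Set
_≤lex_ = Lex-≤ _≡_ _≤_

-- the two admissible choices of ⪯₊
data PlusOrd : Set where
  lexOrd posOrd : PlusOrd

⟦_⟧ : PlusOrd → Str → Str → Set
⟦ lexOrd ⟧ = _≤lex_
⟦ posOrd ⟧ = _≤pos_

IsMin : (Str → Str → Set) → (Str → Set) → Str → Set
IsMin _⪯_ U x = U x × (∀ y → U y → x ⪯ y)

module CDAWG (T : Str) where

  Occurs : Str → Set
  Occurs x = ∃₂ λ i r → x ++ r ≡ drop i T

  RightMaximal : Str → Set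
  RightMaximal x = ∃₂ λ c d → c ≢ d × Occurs (x ∷ʳ c) × Occurs (x ∷ʳ d)

  Leaf : Str → Set
  Leaf z = ∃ λ i → i < length T × drop i T ≡ z

  -- nodes of the suffix tree of T, identified with the strings they spell:
  -- the root, the branching (right-maximal) nodes, and the leaves
  STNode : Str → Set
  STNode z = z ≡ [] ⊎ RightMaximal z ⊎ Leaf z

  -- Edges of the suffix tree: (z , β) is the edge from node z to its child z ++ β,
  -- labelled β.
  STEdge : Set
  STEdge = Str × Str

  src : STEdge → Str
  src = proj₁

  label : STEdge → Str
  label = proj₂

  tgt : STEdge → Str
  tgt e = src e ++ label e

  ValidEdge : STEdge → Set
  ValidEdge (z , β) =
    STNode z × β ≢ [] × STNode (z ++ β) ×
    (∀ β₁ β₂ → β ≡ β₁ ++ β₂ → β₁ ≢ [] → β₂ ≢ [] → ¬ STNode (z ++ β₁))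

  -- The subtrees of the suffix tree rooted at z and z' are isomorphic
  -- (as edge-labelled trees): the sets of descendants coincide up to the
  -- change of root.  The CDAWG nodes are the classes of suffix-tree nodes
  -- under this relation (merging isomorphic subtrees).
  _∼_ : Str → Str → Set
  z ∼ z' = ∀ w → STNode (z ++ w) ⇔ STNode (z' ++ w)

  -- CDAWG edges are classes of suffix-tree edges: merging the subtrees at
  -- z ∼ z' identifies the out-edges of z and z' with equal labels.
  _≈E_ : STEdge → STEdge → Set
  e ≈E e' = src e ∼ src e' × label e ≡ label e'

  _≋_ : List STEdge → List STEdge → Set
  _≋_ = Pointwise _≈E_

  -- root = class of [], sink = class of the leaves (e.g. of T itself)
  root : Str
  root = []

  sink : Str
  sink = T

  data Walk : Str → List STEdge → Str → Set where
    nil  : ∀ {u v} → u ∼ v → Walk u [] v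
    cons : ∀ {u e P v} → ValidEdge e → u ∼ src e → Walk (tgt e) P v → Walk u (e ∷ P) v

  spell : List STEdge → Str
  spell P = concat (map label P)

  U₋ : Str → Str → Set
  U₋ v X = ∃ λ P → Walk root P v × spell P ≡ X

  U₊ : Str → Str → Set
  U₊ v X = ∃ λ P → Walk v P sink × spell P ≡ X

  -- (−)-primary: e is (≈) the last edge of the path spelling repr₋(tgt e),
  -- the ≤pos-minimum of U₋(tgt e)
  EP₋ : STEdge → Set
  EP₋ e = ValidEdge e × ∃₂ λ P e' → e' ≈E e × Walk root (P ∷ʳ e') (tgt e)
          × IsMin _≤pos_ (U₋ (tgt e)) (spell (P ∷ʳ e'))

  -- (+)-primary: e is (≈) the first edge of the path spelling repr₊(src e),
  -- the ⪯₊-minimum of U₊(src e)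
  EP₊ : PlusOrd → STEdge → Set
  EP₊ o e = ValidEdge e × ∃₂ λ e' P → e' ≈E e × Walk (src e) (e' ∷ P) sink
            × IsMin ⟦ o ⟧ (U₊ (src e)) (spell (e' ∷ P))

  ES₋ : STEdge → Set
  ES₋ e = ValidEdge e × ¬ EP₋ e

  ES₊ : PlusOrd → STEdge → Set
  ES₊ o e = ValidEdge e × ¬ EP₊ o e

  IsSearchPath₋ : PlusOrd → List STEdge → List STEdge → Set
  IsSearchPath₋ o F p =
    (All EP₋ F × p ≋ F) ⊎
    (∃ λ pre → ∃₂ λ f post → F ≡ pre ++ f ∷ post × All EP₋ pre × ES₋ f
       × All (EP₊ o) post × p ≋ (pre ∷ʳ f))

  IsSearchPath₊ : PlusOrd → List STEdge → List STEdge → Set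
  IsSearchPath₊ o F p =
    (All (EP₊ o) F × p ≋ F) ⊎
    (∃ λ pre → ∃₂ λ f post → F ≡ pre ++ f ∷ post × All EP₋ pre × ES₊ o f
       × All (EP₊ o) post × p ≋ (f ∷ post))

  -- SP_δ (root-to-sink paths are in bijection with the suffixes of T)
  SP₋ : PlusOrd → List STEdge → Set
  SP₋ o p = ∃ λ F → Walk root F sink × IsSearchPath₋ o F p

  SP₊ : PlusOrd → List STEdge → Set
  SP₊ o p = ∃ λ F → Walk root F sink × IsSearchPath₊ o F p

  PrefixFree : (List STEdge → Set) → Set
  PrefixFree S = ∀ p q r → S p → S q → q ≋ (p ++ r) → r ≡ []

  SuffixFree : (List STEdge → Set) → Set
  SuffixFree S = ∀ p q r → S p → S q → q ≋ (r ++ p) → r ≡ []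

{-# OPTIONS --safe #-}
-- A (−)-search path consists of (−)-primary edges followed by one last edge, and that
-- last edge is (−)-secondary unless the path is a whole root-to-sink path.  If a
-- (−)-search path p were a proper prefix of another one q, then either p ends at the
-- sink and q continues past it, although the sink has no outgoing edge (no node of the
-- suffix tree is longer than T), or the secondary last edge of p is a non-last edge of q
-- and hence primary.  Dually, a (+)-search path is a secondary or first edge followed by
-- (+)-primary edges, and a proper suffix of q would either start at the root, which has
-- no incoming edge, or start with a secondary edge that is a non-first edge of q.
-- Primality only depends on the CDAWG edge, so all of this goes through up to ≋.
module Submission where

open import Level using (Level)
open import Defs
open import Data.List using ([]; _∷_; _++_; _∷ʳ_; drop; length; initLast; _∷ʳ′_)
open import Data.List.Properties
  using (++-assoc; ++-identityʳ; ++-conicalʳ; ∷ʳ-++; length-++; length-++-≤ˡ; length-++-≤ʳ; length-drop)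
open import Data.List.Relation.Unary.All as All using (All; []; _∷_)
open import Data.List.Relation.Unary.All.Properties using (++⁻ʳ; ∷ʳ⁻)
open import Data.List.Relation.Binary.Pointwise as Pointwise using (Pointwise; []; _∷_; All-resp-Pointwise)
open import Data.Nat using (_≤_; _<_; _∸_; z≤n; s≤s)
open import Data.Nat.Properties using (≤-trans; <⇒≱; m∸n≤m; m<m+n; module ≤-Reasoning)
open import Data.Product using (∃; ∃₂; _×_; _,_; proj₁; proj₂)
open import Data.Sum using (_⊎_; inj₁; inj₂)
open import Data.Empty using (⊥-elim)
open import Function using (_∘_)
open import Function.Bundles using (_⇔_; Equivalence)
open import Function.Properties.Equivalence using (⇔-isEquivalence)
open import Relation.Binary.Core using (Rel)
open import Relation.Binary.Definitions using (Reflexive; Symmetric; Transitive; _Respects_)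
open import Relation.Binary.Structures using (IsEquivalence)
open import Relation.Binary.PropositionalEquality using (_≢_; refl; sym; cong; subst; subst₂)
open import Relation.Nullary using (¬_)
open import Relation.Unary using (Pred)

module _ {a ℓ p : Level} {A : Set a} {R : Rel A ℓ} {P : Pred A p} (resp : P Respects R) where

  All-proper-prefix-of-∷ʳ : ∀ {xs x ys y zs} →
    All P xs → Pointwise R (xs ∷ʳ x) (ys ++ y ∷ zs) → All P ys
  All-proper-prefix-of-∷ʳ {ys = []} _ _ = []
  All-proper-prefix-of-∷ʳ {xs = _ ∷ _} {ys = _ ∷ _} (px ∷ pxs) (x≈y ∷ rest) =
    resp x≈y px ∷ All-proper-prefix-of-∷ʳ pxs rest
  All-proper-prefix-of-∷ʳ {xs = []} {ys = _ ∷ []} _ (_ ∷ ())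
  All-proper-prefix-of-∷ʳ {xs = []} {ys = _ ∷ _ ∷ _} _ (_ ∷ ())

IsMin-cong : ∀ {_⪯_ : Str → Str → Set} {U U′ : Str → Set} {x} →
  (∀ {y} → U y → U′ y) → (∀ {y} → U′ y → U y) → IsMin _⪯_ U x → IsMin _⪯_ U′ x
IsMin-cong U⊆U′ U′⊆U (x∈U , x-least) = U⊆U′ x∈U , λ y y∈U′ → x-least y (U′⊆U y∈U′)

module _ (T : Str) where
  open CDAWG T
  private module ⇔ = IsEquivalence (⇔-isEquivalence {ℓ = Level.zero})

  ∼-refl : Reflexive _∼_
  ∼-refl w = ⇔.refl

  ∼-sym : Symmetric _∼_
  ∼-sym h w = ⇔.sym (h w)

  ∼-trans : Transitive _∼_
  ∼-trans h h′ w = ⇔.trans (h w) (h′ w)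

  ∼-++ʳ : ∀ {z z′} β → z ∼ z′ → (z ++ β) ∼ (z′ ++ β)
  ∼-++ʳ {z} {z′} β h w =
    subst₂ (λ s s′ → STNode s ⇔ STNode s′) (sym (++-assoc z β w)) (sym (++-assoc z′ β w)) (h (β ++ w))

  STNode-resp : STNode Respects _∼_
  STNode-resp {z} {z′} h =
    Equivalence.to (subst₂ (λ s s′ → STNode s ⇔ STNode s′) (++-identityʳ z) (++-identityʳ z′) (h []))

  ≈E-sym : Symmetric _≈E_
  ≈E-sym (h , same-label) = ∼-sym h , sym same-label

  ≈E-trans : Transitive _≈E_
  ≈E-trans (h , refl) (h′ , refl) = ∼-trans h h′ , refl

  ≈E-tgt : ∀ {e e′} → e ≈E e′ → tgt e ∼ tgt e′
  ≈E-tgt {_ , β} (h , refl) = ∼-++ʳ β h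

  ≋-sym : Symmetric _≋_
  ≋-sym = Pointwise.symmetric ≈E-sym

  ≋-trans : Transitive _≋_
  ≋-trans = Pointwise.transitive ≈E-trans

  ValidEdge-resp : ValidEdge Respects _≈E_
  ValidEdge-resp {_ , β} (h , refl) (src-node , β≢[] , tgt-node , no-node-inside) =
    STNode-resp h src-node , β≢[] , STNode-resp (∼-++ʳ β h) tgt-node ,
    λ β₁ β₂ β≡β₁β₂ β₁≢[] β₂≢[] node →
      no-node-inside β₁ β₂ β≡β₁β₂ β₁≢[] β₂≢[] (STNode-resp (∼-++ʳ β₁ (∼-sym h)) node)

  walk-start : ∀ {u u′ P v} → u ∼ u′ → Walk u P v → Walk u′ P v
  walk-start h (nil g) = nil (∼-trans (∼-sym h) g)
  walk-start h (cons e-valid g W) = cons e-valid (∼-trans (∼-sym h) g) W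

  walk-end : ∀ {u P v v′} → Walk u P v → v ∼ v′ → Walk u P v′
  walk-end (nil g) h = nil (∼-trans g h)
  walk-end (cons e-valid g W) h = cons e-valid g (walk-end W h)

  walk-≋ : ∀ {u P Q v} → P ≋ Q → Walk u P v → Walk u Q v
  walk-≋ [] (nil g) = nil g
  walk-≋ (e≈e′ ∷ P≋Q) (cons e-valid g W) =
    cons (ValidEdge-resp e≈e′ e-valid) (∼-trans g (proj₁ e≈e′)) (walk-≋ P≋Q (walk-start (≈E-tgt e≈e′) W))

  walk-++⁻ : ∀ {u w} P {Q} → Walk u (P ++ Q) w → ∃ λ m → Walk u P m × Walk m Q w
  walk-++⁻ {u} [] W = u , nil ∼-refl , W
  walk-++⁻ (_ ∷ P) (cons e-valid g W) =
    let m , W₁ , W₂ = walk-++⁻ P W in m , cons e-valid g W₁ , W₂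

  U₋-resp : ∀ {v v′ X} → v ∼ v′ → U₋ v X → U₋ v′ X
  U₋-resp h (P , W , spells-X) = P , walk-end W h , spells-X

  U₊-resp : ∀ {v v′ X} → v ∼ v′ → U₊ v X → U₊ v′ X
  U₊-resp h (P , W , spells-X) = P , walk-start h W , spells-X

  EP₋-resp : EP₋ Respects _≈E_
  EP₋-resp e≈e′ (e-valid , P , e″ , e″≈e , W , minimal) =
    ValidEdge-resp e≈e′ e-valid , P , e″ , ≈E-trans e″≈e e≈e′ , walk-end W t∼t′ ,
    IsMin-cong {_⪯_ = _≤pos_} (U₋-resp t∼t′) (U₋-resp (∼-sym t∼t′)) minimal
    where t∼t′ = ≈E-tgt e≈e′

  EP₊-resp : ∀ o → EP₊ o Respects _≈E_
  EP₊-resp o e≈e′ (e-valid , e″ , P , e″≈e , W , minimal) =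
    ValidEdge-resp e≈e′ e-valid , e″ , P , ≈E-trans e″≈e e≈e′ , walk-start s∼s′ W ,
    IsMin-cong {_⪯_ = ⟦ o ⟧} (U₊-resp s∼s′) (U₊-resp (∼-sym s∼s′)) minimal
    where s∼s′ = proj₁ e≈e′

  Occurs-length : ∀ {x} → Occurs x → length x ≤ length T
  Occurs-length {x} (i , r , x++r≡suffix) = begin
    length x          ≤⟨ length-++-≤ˡ x ⟩
    length (x ++ r)   ≡⟨ cong length x++r≡suffix ⟩
    length (drop i T) ≡⟨ length-drop i T ⟩
    length T ∸ i      ≤⟨ m∸n≤m (length T) i ⟩
    length T          ∎
    where open ≤-Reasoning

  STNode-length : ∀ {x} → STNode x → length x ≤ length T
  STNode-length (inj₁ refl) = z≤n
  STNode-length {x} (inj₂ (inj₁ (_ , _ , _ , xc-occurs , _))) = ≤-trans (length-++-≤ˡ x) (Occurs-length xc-occurs)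
  STNode-length (inj₂ (inj₂ (i , _ , refl))) = Occurs-length (i , [] , ++-identityʳ _)

  ¬STNode-longer : ∀ {x} → length T < length x → ¬ STNode x
  ¬STNode-longer longer node = <⇒≱ longer (STNode-length node)

  no-node-extends-textʳ : ∀ {y} → y ≢ [] → ¬ STNode (T ++ y)
  no-node-extends-textʳ {[]} y≢[] _ = y≢[] refl
  no-node-extends-textʳ {_ ∷ _} _ =
    ¬STNode-longer (subst (length T <_) (sym (length-++ T)) (m<m+n (length T) (s≤s z≤n)))

  no-node-extends-textˡ : ∀ {x} → x ≢ [] → ¬ STNode (x ++ T)
  no-node-extends-textˡ {[]} x≢[] _ = x≢[] refl
  no-node-extends-textˡ {_ ∷ x} _ = ¬STNode-longer (s≤s (length-++-≤ʳ T {x}))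

  sink-has-no-out-edge : ∀ {e} → ValidEdge e → ¬ src e ∼ sink
  sink-has-no-out-edge {_ , β} (_ , β≢[] , tgt-node , _) h =
    no-node-extends-textʳ β≢[] (STNode-resp (∼-++ʳ β h) tgt-node)

  walk-stops-at-sink : ∀ {u P e R v} → Walk u P sink → ¬ Walk u (P ++ e ∷ R) v
  walk-stops-at-sink (nil h) (cons e-valid g _) = sink-has-no-out-edge e-valid (∼-trans (∼-sym g) h)
  walk-stops-at-sink (cons _ _ W) (cons _ _ W′) = walk-stops-at-sink W W′

  SP₋-walk : ∀ o {q} → SP₋ o q → ∃ λ m → Walk root q m
  SP₋-walk _ (_ , W , inj₁ (_ , q≋F)) = sink , walk-≋ (≋-sym q≋F) W
  SP₋-walk _ (_ , W , inj₂ (pre , f , post , refl , _ , _ , _ , q≋pre-f)) =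
    let m , W₁ , _ = walk-++⁻ (pre ∷ʳ f) (subst (λ F → Walk root F sink) (sym (∷ʳ-++ pre f post)) W)
    in m , walk-≋ (≋-sym q≋pre-f) W₁

  SP₋-cases : ∀ o {p} → SP₋ o p → Walk root p sink ⊎ ∃₂ λ pre f → p ≋ (pre ∷ʳ f) × ES₋ f
  SP₋-cases _ (_ , W , inj₁ (_ , p≋F)) = inj₁ (walk-≋ (≋-sym p≋F) W)
  SP₋-cases _ (_ , _ , inj₂ (pre , f , _ , _ , _ , f-secondary , _ , p≋pre-f)) = inj₂ (pre , f , p≋pre-f , f-secondary)

  SP₊-walk : ∀ o {q} → SP₊ o q → ∃ λ m → Walk m q sink
  SP₊-walk _ (_ , W , inj₁ (_ , q≋F)) = root , walk-≋ (≋-sym q≋F) W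
  SP₊-walk _ (_ , W , inj₂ (pre , _ , _ , refl , _ , _ , _ , q≋f-post)) =
    let m , _ , W₂ = walk-++⁻ pre W in m , walk-≋ (≋-sym q≋f-post) W₂

  SP₊-cases : ∀ o {p} → SP₊ o p → Walk root p sink ⊎ ∃₂ λ f post → p ≋ (f ∷ post) × ES₊ o f
  SP₊-cases _ (_ , W , inj₁ (_ , p≋F)) = inj₁ (walk-≋ (≋-sym p≋F) W)
  SP₊-cases _ (_ , _ , inj₂ (_ , f , post , _ , _ , f-secondary , _ , p≋f-post)) = inj₂ (f , post , p≋f-post , f-secondary)

  module _ (T-nonempty : 0 < length T) where

    T-node : STNode T
    T-node = inj₂ (inj₂ (0 , T-nonempty , refl))

    root≁sink : ¬ root ∼ sink
    root≁sink h = ¬STNode-longer (subst (length T <_) (sym (length-++ T)) (m<m+n (length T) T-nonempty))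
                                 (Equivalence.to (h T) T-node)

    root-has-no-in-edge : ∀ {e} → ValidEdge e → ¬ tgt e ∼ root
    root-has-no-in-edge {z , β} (_ , β≢[] , _) h =
      no-node-extends-textˡ (β≢[] ∘ ++-conicalʳ z β) (Equivalence.from (h T) T-node)

    walk-avoids-root : ∀ {u e P v} → Walk u (e ∷ P) v → ¬ v ∼ root
    walk-avoids-root (cons e-valid _ (nil g)) h = root-has-no-in-edge e-valid (∼-trans g h)
    walk-avoids-root (cons _ _ W@(cons _ _ _)) h = walk-avoids-root W h

    root-to-sink-path-starts-at-root : ∀ {P u v} → Walk root P sink → Walk u P v → u ∼ root
    root-to-sink-path-starts-at-root (nil h) _ = ⊥-elim (root≁sink h)
    root-to-sink-path-starts-at-root (cons _ g _) (cons _ g′ _) = ∼-trans g′ (∼-sym g)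

    SP₋-init-primary : ∀ o {q} → SP₋ o q → ∃₂ λ A l → q ≋ (A ∷ʳ l) × All EP₋ A
    SP₋-init-primary _ (F , _ , inj₁ _) with initLast F
    SP₋-init-primary _ (_ , nil h , _) | [] = ⊥-elim (root≁sink h)
    SP₋-init-primary _ (_ , _ , inj₁ (F-primary , q≋F)) | A ∷ʳ′ l = A , l , q≋F , proj₁ (∷ʳ⁻ F-primary)
    SP₋-init-primary _ (_ , _ , inj₂ (pre , f , _ , _ , pre-primary , _ , _ , q≋pre-f)) =
      pre , f , q≋pre-f , pre-primary

    SP₊-tail-primary : ∀ o {q} → SP₊ o q → ∃₂ λ l A → q ≋ (l ∷ A) × All (EP₊ o) A
    SP₊-tail-primary _ (_ , nil h , _) = ⊥-elim (root≁sink h)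
    SP₊-tail-primary _ (l ∷ A , cons _ _ _ , inj₁ (_ ∷ A-primary , q≋F)) = l , A , q≋F , A-primary
    SP₊-tail-primary _ (_ , _ , inj₂ (_ , f , post , _ , _ , _ , post-primary , q≋f-post)) =
      f , post , q≋f-post , post-primary

    SP₋-prefixFree : ∀ o → PrefixFree (SP₋ o)
    SP₋-prefixFree o p q [] _ _ _ = refl
    SP₋-prefixFree o p q (x ∷ r) p-sp q-sp q≋p++xr with SP₋-cases o p-sp
    ... | inj₁ p-walk = ⊥-elim (walk-stops-at-sink p-walk (walk-≋ q≋p++xr (proj₂ (SP₋-walk o q-sp))))
    ... | inj₂ (pre , f , p≋pre-f , _ , f-not-primary) =
      ⊥-elim (f-not-primary (proj₂ (∷ʳ⁻ (All-resp-Pointwise EP₋-resp p≋pre-f p-primary))))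
      where
        p-primary : All EP₋ p
        p-primary = let A , l , q≋A-l , A-primary = SP₋-init-primary o q-sp
                    in All-proper-prefix-of-∷ʳ EP₋-resp A-primary (≋-trans (≋-sym q≋A-l) q≋p++xr)

    SP₊-suffixFree : ∀ o → SuffixFree (SP₊ o)
    SP₊-suffixFree o p q [] _ _ _ = refl
    SP₊-suffixFree o p q (x ∷ r) p-sp q-sp q≋xr++p with SP₊-cases o p-sp
    ... | inj₁ p-walk =
      let _ , q-walk = SP₊-walk o q-sp
          _ , xr-walk , p-walk′ = walk-++⁻ (x ∷ r) (walk-≋ q≋xr++p q-walk)
      in ⊥-elim (walk-avoids-root xr-walk (root-to-sink-path-starts-at-root p-walk p-walk′))
    ... | inj₂ (f , post , p≋f-post , _ , f-not-primary) =
      ⊥-elim (f-not-primary (All.head (All-resp-Pointwise (EP₊-resp o) p≋f-post p-primary)))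
      where
        p-primary : All (EP₊ o) p
        p-primary = let l , A , q≋l-A , A-primary = SP₊-tail-primary o q-sp
                        A≋r++p = Pointwise.tail (≋-trans (≋-sym q≋l-A) q≋xr++p)
                    in ++⁻ʳ r (All-resp-Pointwise (EP₊-resp o) A≋r++p A-primary)

ValidText-nonempty : ∀ {T} → ValidText T → 0 < length T
ValidText-nonempty ([] , _ , refl , _) = s≤s z≤n
ValidText-nonempty (_ ∷ _ , _ , refl , _) = s≤s z≤n

lemma4 : (T : Str) → ValidText T → (o : PlusOrd) →
           CDAWG.PrefixFree T (CDAWG.SP₋ T o) × CDAWG.SuffixFree T (CDAWG.SP₊ T o)
lemma4 T T-valid o = SP₋-prefixFree T T-nonempty o , SP₊-suffixFree T T-nonempty o
  where T-nonempty = ValidText-nonempty T-valid
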